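{- Let $(A,V)$ and $(B,W)$ be permutation groups on finite sets, neither equal to $I_1$, with $A\in DGR\setminus GR$ and $B\in GR$ intransitive. Then $A\times B\in GR$.
   Context: A permutation group $(A,V)$ is a group $A$ of permutations of a set $V$; $I_n$ denotes the trivial group acting on an $n$-element set; groups are considered up to permutation isomorphism. The direct product $A\times B$ acts on $V\times W$ by $(a,b)(x,y)=(a(x),b(y))$. An edge-colored graph on a set $U$ is a function $E$ from the 2-element subsets of $U$ to a finite set of colors, with automorphisms the permutations $\sigma$ of $U$ satisfying $E(\{\sigma(u),\sigma(u')\})=E(\{u,u'\})$ for all distinct $u,u'$; an edge-colored digraph is defined the same way with ordered pairs $(u,u')$, $u\neq u'$, in place of 2-element subsets. $GR$ (resp. $DGR$) is the class of permutation groups that equal the full automorphism group of some edge-colored graph (resp. digraph) on their underlying set. -}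

module Defs where

open import Level using (0ℓ)
open import Data.Nat using (ℕ)
open import Data.Fin using (Fin)
open import Data.Product using (Σ; ∃; ∃-syntax; _×_; _,_)
open import Data.Sum using (_⊎_)
open import Relation.Nullary using (¬_)
open import Relation.Binary.PropositionalEquality using (_≡_)
open import Function.Bundles using (Inverse; _↔_)
open import Function.Properties.Inverse using (↔-refl; ↔-sym)
open import Function.Construct.Composition using (_↔-∘_)

Perm : Set → Set
Perm X = X ↔ X

_≈ₚ_ : {X : Set} → Perm X → Perm X → Set
_≈ₚ_ {X} σ τ = ∀ (x : X) → Inverse.to σ x ≡ Inverse.to τ x

Finite : Set → Set
Finite X = Σ ℕ λ n → X ↔ Fin n

record PermGroup (X : Set) : Set₁ where
  field
    _∈G : Perm X → Set
    resp : ∀ {σ τ} → σ ≈ₚ τ → σ ∈G → τ ∈G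
    id∈ : ↔-refl ∈G
    comp∈ : ∀ {σ τ} → σ ∈G → τ ∈G → (σ ↔-∘ τ) ∈G
    inv∈ : ∀ {σ} → σ ∈G → ↔-sym σ ∈G
open PermGroup public

_∈×_ : {X Y : Set} → PermGroup X → PermGroup Y → Perm (X × Y) → Set
_∈×_ {X} {Y} A B π =
  ∃[ a ] ∃[ b ] ((A ∈G) a × (B ∈G) b ×
    (∀ (x : X) (y : Y) → Inverse.to π (x , y) ≡ (Inverse.to a x , Inverse.to b y)))

-- (A, X) is permutation isomorphic to I₁: X has exactly one element
-- (bijection with Fin 1) and A is the trivial group.
IsI₁ : {X : Set} → PermGroup X → Set
IsI₁ {X} A = (X ↔ Fin 1) × (∀ σ → (A ∈G) σ → σ ≈ₚ ↔-refl)

-- Edge-colored graph on U with k colors: a colouring of 2-element subsets,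
-- represented as a symmetric function on pairs (values on the diagonal are
-- irrelevant: only distinct u, u' are ever used).
record ColGraph (U : Set) : Set where
  field
    colors : ℕ
    E : U → U → Fin colors
    sym : ∀ u u' → ¬ u ≡ u' → E u u' ≡ E u' u
open ColGraph public

-- Edge-colored digraph: colouring of ordered pairs (u,u'), u ≠ u'.
record ColDigraph (U : Set) : Set where
  field
    dcolors : ℕ
    D : U → U → Fin dcolors
open ColDigraph public

IsAutG : {U : Set} → ColGraph U → Perm U → Set
IsAutG {U} Γ σ = ∀ (u u' : U) → ¬ u ≡ u' →
  E Γ (Inverse.to σ u) (Inverse.to σ u') ≡ E Γ u u'

IsAutD : {U : Set} → ColDigraph U → Perm U → Set
IsAutD {U} Δ σ = ∀ (u u' : U) → ¬ u ≡ u' →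
  D Δ (Inverse.to σ u) (Inverse.to σ u') ≡ D Δ u u'

InGR : {U : Set} → (Perm U → Set) → Set
InGR {U} P = ∃[ Γ ] (∀ (σ : Perm U) → (P σ → IsAutG Γ σ) × (IsAutG Γ σ → P σ))

InDGR : {U : Set} → (Perm U → Set) → Set
InDGR {U} P = ∃[ Δ ] (∀ (σ : Perm U) → (P σ → IsAutD Δ σ) × (IsAutD Δ σ → P σ))

Transitive : {X : Set} → PermGroup X → Set
Transitive {X} A = ∀ (x y : X) → ∃[ σ ] ((A ∈G) σ × Inverse.to σ x ≡ y)

{-# OPTIONS --safe #-}
-- Colour the pairs of points of V × W: two points with the same V-coordinate
-- carry the Γ-colour of their W-coordinates, two points with the same
-- W-coordinate a colour of their own, and two points on opposite sides of a
-- B-orbit S ⊂ W carry the Δ-colour of their V-coordinates, read from the point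
-- over S to the point off S; all remaining pairs get one further colour.
-- Reading Δ across S is what lets an undirected graph encode the digraph Δ, and
-- S is a proper nonempty subset because B is intransitive. An automorphism
-- preserves both fibre relations, so it is a product a × b; b preserves Γ on a
-- fibre, hence lies in B and fixes S, and comparing a pair across S then shows
-- that a preserves Δ, i.e. lies in A. Conversely every a × b with a ∈ A and
-- b ∈ B preserves the colouring.
module Submission where

open import Defs hiding (sym)
open import Data.Product using (_×_)
open import Relation.Nullary using (¬_)

open import Data.Bool using (Bool; true; false; if_then_else_)
open import Data.Fin using (Fin; zero; suc)
open import Data.Fin.Properties using (¬Fin0; any?; +↔⊎) renaming (_≟_ to _≟ᶠ_)
open import Data.Nat using (zero; suc; _+_)
open import Data.Product using (∃; ∃-syntax; Σ-syntax; _,_; proj₁; proj₂)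
open import Data.Product.Properties using (,-injectiveˡ; ,-injectiveʳ)
open import Data.Sum using (_⊎_; inj₁; inj₂)
open import Data.Sum.Properties using (inj₁-injective; inj₂-injective)
open import Data.Sum.Function.Propositional using (_⊎-↔_)
open import Data.Vec.Functional using (_∷_; head; tail)
open import Function using (_∘_)
open import Function.Bundles using (Inverse; _↔_; mk↔ₛ′; Injection; _⇔_; mk⇔)
open import Function.Properties.Inverse using (↔-refl; ↔-sym; ↔⇒↣)
open import Function.Construct.Composition using (_↔-∘_)
open import Relation.Binary.Definitions using (DecidableEquality)
open import Relation.Binary.PropositionalEquality
  using (_≡_; refl; sym; trans; cong; cong₂; subst; _≗_; module ≡-Reasoning)
open import Relation.Nullary using (Dec; yes; no; does; contradiction)
open import Relation.Nullary.Decidable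
  using (map; map′; dec-true; dec-false; does-⇔; via-injection; ¬?; _×-dec_; _→-dec_; decidable-stable)
open import Relation.Unary using (Decidable)

open Inverse using (to; from; strictlyInverseˡ; strictlyInverseʳ)

to-injective : {X Y : Set} (ψ : X ↔ Y) {x x′ : X} → to ψ x ≡ to ψ x′ → x ≡ x′
to-injective ψ = Injection.injective (↔⇒↣ ψ)

finite-≟ : {X : Set} → Finite X → DecidableEquality X
finite-≟ (_ , ψ) = via-injection (↔⇒↣ ψ) _≟ᶠ_

finite-dec : {X : Set} → Finite X → Dec X
finite-dec (zero , ψ) = no (¬Fin0 ∘ to ψ)
finite-dec (suc n , ψ) = yes (from ψ zero)

finite-any? : {X : Set} {P : X → Set} → Finite X → Decidable P → Dec (∃ P)
finite-any? {P = P} (_ , ψ) P? =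
  map′ (λ (i , p) → from ψ i , p)
       (λ (x , p) → to ψ x , subst P (sym (strictlyInverseʳ ψ x)) p)
       (any? (P? ∘ from ψ))

finite-all? : {X : Set} {P : X → Set} → Finite X → Decidable P → Dec (∀ x → P x)
finite-all? {P = P} finX P? =
  map′ (λ ¬∃¬ x → decidable-stable (P? x) (¬∃¬ ∘ (x ,_)))
       (λ ∀P (x , ¬p) → ¬p (∀P x))
       (¬? (finite-any? finX (¬? ∘ P?)))

finite-¬∀⇒∃¬ : {X : Set} {P : X → Set} → Finite X → Decidable P →
  ¬ (∀ x → P x) → ∃ λ x → ¬ P x
finite-¬∀⇒∃¬ finX P? ¬∀P with finite-any? finX (¬? ∘ P?)
... | yes ∃¬P = ∃¬P
... | no ¬∃¬P = contradiction (λ x → decidable-stable (P? x) (¬∃¬P ∘ (x ,_))) ¬∀P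

any-Fin-function? : ∀ n {Y : Set} {P : (Fin n → Y) → Set} → Finite Y →
  (∀ {f g} → f ≗ g → P f → P g) → Decidable P → Dec (∃ P)
any-Fin-function? zero {Y} finY resp P? = map′ (empty ,_) (λ (f , p) → resp (λ ()) p) (P? empty)
  where
  empty : Fin zero → Y
  empty ()
any-Fin-function? (suc n) {Y} finY resp P? =
  map′ (λ (y , f , p) → y ∷ f , p)
       (λ (f , p) → head f , tail f , resp head∷tail p)
       (finite-any? finY λ y → any-Fin-function? n finY (resp ∘ cons-cong) (P? ∘ (y ∷_)))
  where
  head∷tail : {f : Fin (suc n) → Y} → f ≗ head f ∷ tail f
  head∷tail zero = refl
  head∷tail (suc i) = refl
  cons-cong : ∀ {y} {f g : Fin n → Y} → f ≗ g → y ∷ f ≗ y ∷ g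
  cons-cong f≗g zero = refl
  cons-cong f≗g (suc i) = f≗g i

any-function? : {X Y : Set} {P : (X → Y) → Set} → Finite X → Finite Y →
  (∀ {f g} → f ≗ g → P f → P g) → Decidable P → Dec (∃ P)
any-function? (n , ψ) finY resp P? =
  map′ (λ (g , p) → g ∘ to ψ , p)
       (λ (f , p) → f ∘ from ψ , resp (λ x → cong f (sym (strictlyInverseʳ ψ x))) p)
       (any-Fin-function? n finY (λ f≗g → resp (f≗g ∘ to ψ)) (P? ∘ (_∘ to ψ)))

IsAutG-inverse : {U : Set} (Γ : ColGraph U) (σ : Perm U) → IsAutG Γ σ → IsAutG Γ (↔-sym σ)
IsAutG-inverse Γ σ σ-aut u u′ u≢u′ =
  trans (sym (σ-aut (from σ u) (from σ u′) (u≢u′ ∘ to-injective (↔-sym σ))))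
        (cong₂ (E Γ) (strictlyInverseˡ σ u) (strictlyInverseˡ σ u′))

Orbit : {W : Set} → PermGroup W → W → W → Set
Orbit B x y = ∃[ σ ] ((B ∈G) σ × to σ x ≡ y)

Orbit-invariant : {W : Set} (B : PermGroup W) {b : Perm W} → (B ∈G) b →
  ∀ x w → Orbit B x (to b w) ⇔ Orbit B x w
Orbit-invariant B {b} b∈B x w = mk⇔
  (λ (σ , σ∈B , σx≡bw) → ↔-sym b ↔-∘ σ , comp∈ B (inv∈ B b∈B) σ∈B ,
                          trans (cong (from b) σx≡bw) (strictlyInverseʳ b w))
  (λ (σ , σ∈B , σx≡w) → b ↔-∘ σ , comp∈ B b∈B σ∈B , cong (to b) σx≡w)

IsAutPair : {W : Set} → ColGraph W → (W → W) → (W → W) → Set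
IsAutPair Γ f g =
  (∀ w → f (g w) ≡ w) × (∀ w → g (f w) ≡ w) ×
  (∀ u u′ → ¬ u ≡ u′ → E Γ (f u) (f u′) ≡ E Γ u u′)

IsAutPair-resp : {W : Set} (Γ : ColGraph W) {f f′ g g′ : W → W} → f ≗ f′ → g ≗ g′ →
  IsAutPair Γ f g → IsAutPair Γ f′ g′
IsAutPair-resp Γ {f} {f′} {g} {g′} f≗f′ g≗g′ (fg , gf , f-aut) =
  (λ w → trans (sym (f≗f′ (g′ w))) (trans (cong f (sym (g≗g′ w))) (fg w))) ,
  (λ w → trans (sym (g≗g′ (f′ w))) (trans (cong g (sym (f≗f′ w))) (gf w))) ,
  (λ u u′ u≢u′ → trans (sym (cong₂ (E Γ) (f≗f′ u) (f≗f′ u′))) (f-aut u u′ u≢u′))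

IsAutPair? : {W : Set} → Finite W → (Γ : ColGraph W) → ∀ f g → Dec (IsAutPair Γ f g)
IsAutPair? {W} finW Γ f g =
  finite-all? finW (λ w → f (g w) ≟ w) ×-dec
  finite-all? finW (λ w → g (f w) ≟ w) ×-dec
  finite-all? finW (λ u → finite-all? finW λ u′ →
    ¬? (u ≟ u′) →-dec (E Γ (f u) (f u′) ≟ᶠ E Γ u u′))
  where
  _≟_ : DecidableEquality W
  _≟_ = finite-≟ finW

AutPair⇔Orbit : {W : Set} (B : PermGroup W) (Γ : ColGraph W) →
  (∀ σ → ((B ∈G) σ → IsAutG Γ σ) × (IsAutG Γ σ → (B ∈G) σ)) →
  ∀ x y → (∃[ f ] ∃[ g ] (IsAutPair Γ f g × f x ≡ y)) ⇔ Orbit B x y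
AutPair⇔Orbit B Γ B≐AutΓ x y = mk⇔
  (λ (f , g , (fg , gf , f-aut) , fx≡y) → mk↔ₛ′ f g fg gf , proj₂ (B≐AutΓ _) f-aut , fx≡y)
  (λ (σ , σ∈B , σx≡y) → to σ , from σ ,
     (strictlyInverseˡ σ , strictlyInverseʳ σ , proj₁ (B≐AutΓ σ) σ∈B) , σx≡y)

-- B is only known as the automorphism group of Γ, so orbits are decided by a
-- search through all pairs of mutually inverse maps W → W.
orbit? : {W : Set} → Finite W → (B : PermGroup W) → InGR (B ∈G) → ∀ x y → Dec (Orbit B x y)
orbit? {W} finW B (Γ , B≐AutΓ) x y =
  map (AutPair⇔Orbit B Γ B≐AutΓ x y)
      (any-function? finW finW resp-f λ f →
         any-function? finW finW resp-g λ g → IsAutPair? finW Γ f g ×-dec (f x ≟ y))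
  where
  _≟_ : DecidableEquality W
  _≟_ = finite-≟ finW
  resp-f : ∀ {f f′} → f ≗ f′ →
    ∃[ g ] (IsAutPair Γ f g × f x ≡ y) → ∃[ g ] (IsAutPair Γ f′ g × f′ x ≡ y)
  resp-f f≗f′ (g , p , fx≡y) =
    g , IsAutPair-resp Γ f≗f′ (λ _ → refl) p , trans (sym (f≗f′ x)) fx≡y
  resp-g : ∀ {f g g′} → g ≗ g′ → IsAutPair Γ f g × f x ≡ y → IsAutPair Γ f g′ × f x ≡ y
  resp-g g≗g′ (p , fx≡y) = IsAutPair-resp Γ (λ _ → refl) g≗g′ p , fx≡y

intransitive-witness : {W : Set} → Finite W → (B : PermGroup W) →
  (∀ x y → Dec (Orbit B x y)) → ¬ Transitive B → ∃[ x ] ∃[ y ] ¬ Orbit B x y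
intransitive-witness finW B orbit? B-intransitive =
  let (x , ¬∀Orbit) = finite-¬∀⇒∃¬ finW (λ x → finite-all? finW (orbit? x)) B-intransitive
      (y , x≁y) = finite-¬∀⇒∃¬ finW (orbit? x) ¬∀Orbit
  in x , y , x≁y

empty-InGR : {X : Set} → ¬ X → (A : PermGroup X) → InGR (A ∈G)
empty-InGR {X} ¬x A =
  trivial , λ σ → (λ _ _ _ _ → refl) , (λ _ → resp A (λ x → contradiction x ¬x) (id∈ A))
  where
  trivial : ColGraph X
  trivial = record { colors = 1 ; E = λ _ _ → zero ; sym = λ _ _ _ → refl }

_≐_ : {X : Set} → (Perm X → Set) → (Perm X → Set) → Set
P ≐ Q = ∀ σ → (P σ → Q σ) × (Q σ → P σ)

≐-sym : {X : Set} {P Q : Perm X → Set} → P ≐ Q → Q ≐ P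
≐-sym P≐Q σ = proj₂ (P≐Q σ) , proj₁ (P≐Q σ)

InGR-resp : {X : Set} {P Q : Perm X → Set} → P ≐ Q → InGR P → InGR Q
InGR-resp P≐Q (Γ , P≐AutΓ) =
  Γ , λ σ → proj₁ (P≐AutΓ σ) ∘ proj₂ (P≐Q σ) , proj₁ (P≐Q σ) ∘ proj₂ (P≐AutΓ σ)

_⊗_ : {X Y : Set} → (Perm X → Set) → (Perm Y → Set) → Perm (X × Y) → Set
(P ⊗ Q) π = ∃[ a ] ∃[ b ] (P a × Q b × (∀ x y → to π (x , y) ≡ (to a x , to b y)))

⊗-resp : {X Y : Set} {P P′ : Perm X → Set} {Q Q′ : Perm Y → Set} →
  P ≐ P′ → Q ≐ Q′ → (P ⊗ Q) ≐ (P′ ⊗ Q′)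
⊗-resp P≐P′ Q≐Q′ π =
  (λ (a , b , pa , qb , π≡a×b) → a , b , proj₁ (P≐P′ a) pa , proj₁ (Q≐Q′ b) qb , π≡a×b) ,
  (λ (a , b , pa , qb , π≡a×b) → a , b , proj₂ (P≐P′ a) pa , proj₂ (Q≐Q′ b) qb , π≡a×b)

module ProductGraph {V W : Set} (_≟ⱽ_ : DecidableEquality V) (_≟ᵂ_ : DecidableEquality W)
  (Δ : ColDigraph V) (Γ : ColGraph W) (S : W → Bool)
  (S-invariant : ∀ b → IsAutG Γ b → ∀ w → S (to b w) ≡ S w) where

  Colour : Set
  Colour = Fin (colors Γ) ⊎ Fin (dcolors Δ) ⊎ Fin 2

  pattern fibre c = inj₁ c
  pattern cross d = inj₂ (inj₁ d)
  pattern column = inj₂ (inj₂ zero)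
  pattern parallel = inj₂ (inj₂ (suc zero))

  crossing : Bool → Bool → Fin (dcolors Δ) → Fin (dcolors Δ) → Colour
  crossing true false d d′ = cross d
  crossing false true d d′ = cross d′
  crossing _ _ _ _ = parallel

  crossing-comm : ∀ s s′ d d′ → crossing s s′ d d′ ≡ crossing s′ s d′ d
  crossing-comm true true _ _ = refl
  crossing-comm true false _ _ = refl
  crossing-comm false true _ _ = refl
  crossing-comm false false _ _ = refl

  crossing≢fibre : ∀ s s′ {d d′ c} → ¬ crossing s s′ d d′ ≡ fibre c
  crossing≢fibre true true ()
  crossing≢fibre true false ()
  crossing≢fibre false true ()
  crossing≢fibre false false ()

  crossing≢column : ∀ s s′ {d d′} → ¬ crossing s s′ d d′ ≡ column
  crossing≢column true true ()
  crossing≢column true false ()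
  crossing≢column false true ()
  crossing≢column false false ()

  colour : V × W → V × W → Colour
  colour (v , w) (v′ , w′) =
    if does (v ≟ⱽ v′) then fibre (E Γ w w′)
    else if does (w ≟ᵂ w′) then column
    else crossing (S w) (S w′) (D Δ v v′) (D Δ v′ v)

  colour-fibre : ∀ {v v′ w w′} → v ≡ v′ → colour (v , w) (v′ , w′) ≡ fibre (E Γ w w′)
  colour-fibre {v} {v′} v≡v′ rewrite dec-true (v ≟ⱽ v′) v≡v′ = refl

  colour-column : ∀ {v v′ w w′} → ¬ v ≡ v′ → w ≡ w′ → colour (v , w) (v′ , w′) ≡ column
  colour-column {v} {v′} {w} {w′} v≢v′ w≡w′
    rewrite dec-false (v ≟ⱽ v′) v≢v′ | dec-true (w ≟ᵂ w′) w≡w′ = refl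

  colour-crossing : ∀ {v v′ w w′} → ¬ v ≡ v′ → ¬ w ≡ w′ →
    colour (v , w) (v′ , w′) ≡ crossing (S w) (S w′) (D Δ v v′) (D Δ v′ v)
  colour-crossing {v} {v′} {w} {w′} v≢v′ w≢w′
    rewrite dec-false (v ≟ⱽ v′) v≢v′ | dec-false (w ≟ᵂ w′) w≢w′ = refl

  S-separates : ∀ {x y} → S x ≡ true → S y ≡ false → ¬ x ≡ y
  S-separates Sx Sy refl with () ← trans (sym Sx) Sy

  colour-across : ∀ {v v′ x y} → ¬ v ≡ v′ → S x ≡ true → S y ≡ false →
    colour (v , x) (v′ , y) ≡ cross (D Δ v v′)
  colour-across v≢v′ Sx Sy rewrite colour-crossing v≢v′ (S-separates Sx Sy) | Sx | Sy = refl

  colour-fibre⇒≡ : ∀ {v v′ w w′ c} → colour (v , w) (v′ , w′) ≡ fibre c → v ≡ v′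
  colour-fibre⇒≡ {v} {v′} {w} {w′} eq with v ≟ⱽ v′ | w ≟ᵂ w′
  ... | yes v≡v′ | _ = v≡v′
  ... | no _ | yes _ = contradiction eq λ ()
  ... | no _ | no _ = contradiction eq (crossing≢fibre (S w) (S w′))

  colour-column⇒≡ : ∀ {v v′ w w′} → colour (v , w) (v′ , w′) ≡ column → w ≡ w′
  colour-column⇒≡ {v} {v′} {w} {w′} eq with v ≟ⱽ v′ | w ≟ᵂ w′
  ... | yes _ | _ = contradiction eq λ ()
  ... | no _ | yes w≡w′ = w≡w′
  ... | no _ | no _ = contradiction eq (crossing≢column (S w) (S w′))

  colour-comm : ∀ {u u′} → ¬ u ≡ u′ → colour u u′ ≡ colour u′ u
  colour-comm {v , w} {v′ , w′} u≢u′ with v ≟ⱽ v′ | w ≟ᵂ w′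
  ... | yes refl | yes refl = contradiction refl u≢u′
  ... | yes refl | no w≢w′ =
    trans (cong fibre (ColGraph.sym Γ w w′ w≢w′)) (sym (colour-fibre refl))
  ... | no v≢v′ | yes refl = sym (colour-column (v≢v′ ∘ sym) refl)
  ... | no v≢v′ | no w≢w′ =
    trans (crossing-comm (S w) (S w′) _ _) (sym (colour-crossing (v≢v′ ∘ sym) (w≢w′ ∘ sym)))

  Colour↔Fin : Colour ↔ Fin (colors Γ + (dcolors Δ + 2))
  Colour↔Fin = ↔-sym ((↔-refl ⊎-↔ +↔⊎) ↔-∘ +↔⊎)

  graph : ColGraph (V × W)
  graph = record
    { colors = colors Γ + (dcolors Δ + 2)
    ; E = λ u u′ → to Colour↔Fin (colour u u′)
    ; sym = λ _ _ → cong (to Colour↔Fin) ∘ colour-comm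
    }

  aut-preserves-colour : ∀ σ → IsAutG graph σ →
    ∀ u u′ → ¬ u ≡ u′ → colour (to σ u) (to σ u′) ≡ colour u u′
  aut-preserves-colour σ σ-aut u u′ u≢u′ = to-injective Colour↔Fin (σ-aut u u′ u≢u′)

  product-preserves-colour : ∀ a b → IsAutD Δ a → IsAutG Γ b →
    ∀ {v v′ w w′} → ¬ (v , w) ≡ (v′ , w′) →
    colour (to a v , to b w) (to a v′ , to b w′) ≡ colour (v , w) (v′ , w′)
  product-preserves-colour a b a-aut b-aut {v} {v′} {w} {w′} u≢u′ with v ≟ⱽ v′ | w ≟ᵂ w′
  ... | yes refl | yes refl = contradiction refl u≢u′
  ... | yes refl | no w≢w′ = trans (colour-fibre refl) (cong fibre (b-aut w w′ w≢w′))
  ... | no v≢v′ | yes refl = colour-column (v≢v′ ∘ to-injective a) refl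
  ... | no v≢v′ | no w≢w′ = begin
    colour (to a v , to b w) (to a v′ , to b w′)
      ≡⟨ colour-crossing (v≢v′ ∘ to-injective a) (w≢w′ ∘ to-injective b) ⟩
    crossing (S (to b w)) (S (to b w′)) (D Δ (to a v) (to a v′)) (D Δ (to a v′) (to a v))
      ≡⟨ cong₂ (λ s s′ → crossing s s′ _ _) (S-invariant b b-aut w) (S-invariant b b-aut w′) ⟩
    crossing (S w) (S w′) (D Δ (to a v) (to a v′)) (D Δ (to a v′) (to a v))
      ≡⟨ cong₂ (crossing (S w) (S w′)) (a-aut v v′ v≢v′) (a-aut v′ v (v≢v′ ∘ sym)) ⟩
    crossing (S w) (S w′) (D Δ v v′) (D Δ v′ v) ∎
    where open ≡-Reasoning

  product-aut : ∀ π → (IsAutD Δ ⊗ IsAutG Γ) π → IsAutG graph π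
  product-aut π (a , b , a-aut , b-aut , π≡a×b) (v , w) (v′ , w′) u≢u′
    rewrite π≡a×b v w | π≡a×b v′ w′ =
      cong (to Colour↔Fin) (product-preserves-colour a b a-aut b-aut u≢u′)

  module Factors (v₀ : V) (w₀ : W) (σ : Perm (V × W)) (σ-aut : IsAutG graph σ) where

    a : V → V
    a v = proj₁ (to σ (v , w₀))

    b : W → W
    b w = proj₂ (to σ (v₀ , w))

    proj₁-factors : ∀ v w → proj₁ (to σ (v , w)) ≡ a v
    proj₁-factors v w with w ≟ᵂ w₀
    ... | yes refl = refl
    ... | no w≢w₀ = colour-fibre⇒≡ (trans
      (aut-preserves-colour σ σ-aut (v , w) (v , w₀) (w≢w₀ ∘ ,-injectiveʳ))
      (colour-fibre refl))

    proj₂-factors : ∀ v w → proj₂ (to σ (v , w)) ≡ b w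
    proj₂-factors v w with v ≟ⱽ v₀
    ... | yes refl = refl
    ... | no v≢v₀ = colour-column⇒≡ (trans
      (aut-preserves-colour σ σ-aut (v , w) (v₀ , w) (v≢v₀ ∘ ,-injectiveˡ))
      (colour-column v≢v₀ refl))

    factors : ∀ v w → to σ (v , w) ≡ (a v , b w)
    factors v w = cong₂ _,_ (proj₁-factors v w) (proj₂-factors v w)

  aut-factors : V → W → ∀ σ → IsAutG graph σ →
    Σ[ a ∈ Perm V ] Σ[ b ∈ Perm W ] (∀ v w → to σ (v , w) ≡ (to a v , to b w))
  aut-factors v₀ w₀ σ σ-aut =
    mk↔ₛ′ a σ⁻¹.a (λ v → ,-injectiveˡ (σσ⁻¹ v w₀)) (λ v → ,-injectiveˡ (σ⁻¹σ v w₀)) ,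
    mk↔ₛ′ b σ⁻¹.b (,-injectiveʳ ∘ σσ⁻¹ v₀) (,-injectiveʳ ∘ σ⁻¹σ v₀) ,
    factors
    where
    open Factors v₀ w₀ σ σ-aut
    module σ⁻¹ = Factors v₀ w₀ (↔-sym σ) (IsAutG-inverse graph σ σ-aut)
    open ≡-Reasoning
    σσ⁻¹ : ∀ v w → (a (σ⁻¹.a v) , b (σ⁻¹.b w)) ≡ (v , w)
    σσ⁻¹ v w = begin
      (a (σ⁻¹.a v) , b (σ⁻¹.b w)) ≡⟨ factors _ _ ⟨
      to σ (σ⁻¹.a v , σ⁻¹.b w)    ≡⟨ cong (to σ) (σ⁻¹.factors v w) ⟨
      to σ (from σ (v , w))       ≡⟨ strictlyInverseˡ σ (v , w) ⟩
      (v , w)                     ∎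
    σ⁻¹σ : ∀ v w → (σ⁻¹.a (a v) , σ⁻¹.b (b w)) ≡ (v , w)
    σ⁻¹σ v w = begin
      (σ⁻¹.a (a v) , σ⁻¹.b (b w)) ≡⟨ σ⁻¹.factors _ _ ⟨
      from σ (a v , b w)          ≡⟨ cong (from σ) (factors v w) ⟨
      from σ (to σ (v , w))       ≡⟨ strictlyInverseʳ σ (v , w) ⟩
      (v , w)                     ∎

  factorʷ-aut : V → (σ : Perm (V × W)) (a : Perm V) (b : Perm W) →
    IsAutG graph σ → (∀ v w → to σ (v , w) ≡ (to a v , to b w)) → IsAutG Γ b
  factorʷ-aut v₀ σ a b σ-aut σ≡a×b w w′ w≢w′ = inj₁-injective (begin
    fibre (E Γ (to b w) (to b w′))
      ≡⟨ colour-fibre refl ⟨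
    colour (to a v₀ , to b w) (to a v₀ , to b w′)
      ≡⟨ cong₂ colour (σ≡a×b v₀ w) (σ≡a×b v₀ w′) ⟨
    colour (to σ (v₀ , w)) (to σ (v₀ , w′))
      ≡⟨ aut-preserves-colour σ σ-aut _ _ (w≢w′ ∘ ,-injectiveʳ) ⟩
    colour (v₀ , w) (v₀ , w′)
      ≡⟨ colour-fibre refl ⟩
    fibre (E Γ w w′) ∎)
    where open ≡-Reasoning

  factorᵛ-aut : ∀ {x₀ y₀} → S x₀ ≡ true → S y₀ ≡ false →
    (σ : Perm (V × W)) (a : Perm V) (b : Perm W) →
    IsAutG graph σ → (∀ v w → to σ (v , w) ≡ (to a v , to b w)) → IsAutD Δ a
  factorᵛ-aut {x₀} {y₀} Sx₀ Sy₀ σ a b σ-aut σ≡a×b v v′ v≢v′ =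
    inj₁-injective (inj₂-injective (begin
      cross (D Δ (to a v) (to a v′))
        ≡⟨ colour-across (v≢v′ ∘ to-injective a) (S-fixed Sx₀) (S-fixed Sy₀) ⟨
      colour (to a v , to b x₀) (to a v′ , to b y₀)
        ≡⟨ cong₂ colour (σ≡a×b v x₀) (σ≡a×b v′ y₀) ⟨
      colour (to σ (v , x₀)) (to σ (v′ , y₀))
        ≡⟨ aut-preserves-colour σ σ-aut _ _ (v≢v′ ∘ ,-injectiveˡ) ⟩
      colour (v , x₀) (v′ , y₀)
        ≡⟨ colour-across v≢v′ Sx₀ Sy₀ ⟩
      cross (D Δ v v′) ∎))
    where
    open ≡-Reasoning
    S-fixed : ∀ {w s} → S w ≡ s → S (to b w) ≡ s
    S-fixed = trans (S-invariant b (factorʷ-aut v σ a b σ-aut σ≡a×b) _)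

  graph-InGR : V → ∀ {x₀ y₀} → S x₀ ≡ true → S y₀ ≡ false → InGR (IsAutD Δ ⊗ IsAutG Γ)
  graph-InGR v₀ {x₀} Sx₀ Sy₀ = graph , λ σ → product-aut σ , λ σ-aut →
    let (a , b , σ≡a×b) = aut-factors v₀ x₀ σ σ-aut
    in a , b , factorᵛ-aut Sx₀ Sy₀ σ a b σ-aut σ≡a×b ,
       factorʷ-aut v₀ σ a b σ-aut σ≡a×b , σ≡a×b

inhabited-unless-InGR : {X : Set} → Finite X → (A : PermGroup X) → ¬ InGR (A ∈G) → X
inhabited-unless-InGR finX A A∉GR with finite-dec finX
... | yes x = x
... | no ¬x = contradiction (empty-InGR ¬x A) A∉GR

corollary3p10 : {V W : Set} → Finite V → Finite W →
    (A : PermGroup V) → (B : PermGroup W) →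
    ¬ IsI₁ A → ¬ IsI₁ B →
    InDGR (A ∈G) → ¬ InGR (A ∈G) →
    InGR (B ∈G) → ¬ Transitive B →
    InGR (A ∈× B)
corollary3p10 {W = W} finV finW A B _ _ (Δ , A≐AutΔ) A∉GR B∈GR@(Γ , B≐AutΓ) B-intransitive =
  InGR-resp (⊗-resp (≐-sym A≐AutΔ) (≐-sym B≐AutΓ))
    (graph-InGR (inhabited-unless-InGR finV A A∉GR) x₀∈S y₀∉S)
  where
  orbitᴮ? : ∀ x y → Dec (Orbit B x y)
  orbitᴮ? = orbit? finW B B∈GR
  witness : ∃[ x ] ∃[ y ] ¬ Orbit B x y
  witness = intransitive-witness finW B orbitᴮ? B-intransitive
  x₀ y₀ : W
  x₀ = proj₁ witness
  y₀ = proj₁ (proj₂ witness)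
  S : W → Bool
  S w = does (orbitᴮ? x₀ w)
  S-invariant : ∀ b → IsAutG Γ b → ∀ w → S (to b w) ≡ S w
  S-invariant b b-aut w = does-⇔ (Orbit-invariant B (proj₂ (B≐AutΓ b) b-aut) x₀ w)
    (orbitᴮ? x₀ (to b w)) (orbitᴮ? x₀ w)
  x₀∈S : S x₀ ≡ true
  x₀∈S = dec-true (orbitᴮ? x₀ x₀) (↔-refl , id∈ B , refl)
  y₀∉S : S y₀ ≡ false
  y₀∉S = dec-false (orbitᴮ? x₀ y₀) (proj₂ (proj₂ witness))
  open ProductGraph (finite-≟ finV) (finite-≟ finW) Δ Γ S S-invariant
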